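{- Let $\ell\ge 1$, $n\ge 1$, and let $\mathcal{C}$ be a family of $(\ell+1)$-subsets of $[n]$. Then $\mathcal{C}$ satisfies the condition (C$_{\ell+1}$): if $C_1,C_2\in\mathcal{C}$ and $|C_1\cup C_2|=\ell+2$, then every $(\ell+1)$-subset of $C_1\cup C_2$ belongs to $\mathcal{C}$, if and only if there exists an $\ell$-generic matroid on $[n]$ whose family of all $(\ell+1)$-element circuits is exactly $\mathcal{C}$.
   Context: $[n]=\{1,\ldots,n\}$. A matroid is $\ell$-generic if it has no circuits of cardinality $i$ for any $i\le\ell$ (so $1$-generic means loopless and $2$-generic means simple). -}

module Defs where

open import Data.Nat using (ℕ; suc; _<_)
open import Data.Bool using (Bool; T)
open import Data.Fin using (Fin)
open import Data.Fin.Subset using (Subset; _∈_; _⊆_; _∪_; _∩_; _-_; ∣_∣; ⊥)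
open import Data.Product using (Σ; ∃; _×_)
open import Relation.Binary.PropositionalEquality using (_≡_)
open import Relation.Nullary using (¬_)
open import Level using (0ℓ) renaming (suc to lsuc)

record Matroid (n : ℕ) : Set₁ where
  field
    IsCircuit : Subset n → Set
    empty-not-circuit : ¬ IsCircuit ⊥
    incomparable : ∀ C₁ C₂ → IsCircuit C₁ → IsCircuit C₂ → C₁ ⊆ C₂ → C₁ ≡ C₂
    elimination : ∀ C₁ C₂ (e : Fin n) → IsCircuit C₁ → IsCircuit C₂ → ¬ (C₁ ≡ C₂) →
                  e ∈ C₁ ∩ C₂ →
                  Σ (Subset n) λ C₃ → IsCircuit C₃ × C₃ ⊆ (C₁ ∪ C₂) - e
open Matroid public

IsGeneric : ∀ {n} → ℕ → Matroid n → Set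
IsGeneric ℓ M = ∀ C → IsCircuit M C → ℓ < ∣ C ∣

Family : ℕ → Set
Family n = Subset n → Bool

_∈𝒞_ : ∀ {n} → Subset n → Family n → Set
X ∈𝒞 𝒞 = T (𝒞 X)

Cond : ∀ {n} → ℕ → Family n → Set
Cond {n} ℓ 𝒞 = ∀ C₁ C₂ → C₁ ∈𝒞 𝒞 → C₂ ∈𝒞 𝒞 → ∣ C₁ ∪ C₂ ∣ ≡ suc (suc ℓ) →
               ∀ (X : Subset n) → X ⊆ C₁ ∪ C₂ → ∣ X ∣ ≡ suc ℓ → X ∈𝒞 𝒞

CircuitsOfSize≡ : ∀ {n} → ℕ → Matroid n → Family n → Set
CircuitsOfSize≡ {n} ℓ M 𝒞 =
  ∀ (X : Subset n) → ((IsCircuit M X × ∣ X ∣ ≡ suc ℓ) → X ∈𝒞 𝒞) × (X ∈𝒞 𝒞 → IsCircuit M X × ∣ X ∣ ≡ suc ℓ)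

-- In an ℓ-generic matroid two (ℓ+1)-circuits whose union V has ℓ+2 elements
-- eliminate any common element e to a circuit inside V − e; genericity forces
-- that circuit to be all of V − e, and every (ℓ+1)-subset of V is of this form.
-- Conversely, given 𝒞, declare as circuits the members of 𝒞 together with the
-- (ℓ+2)-sets containing no member of 𝒞. Elimination on two circuits with union
-- V and common element e either finds ℓ+2 elements in V − e, and hence a
-- circuit, or forces |V| = ℓ+2, in which case (C_{ℓ+1}) says V − e ∈ 𝒞.
module Submission where

open import Defs
open import Data.Nat using (ℕ; suc; _≤_; _<_; s≤s; _≤?_)
open import Data.Nat.Properties
  using (≤-reflexive; ≤-trans; ≤-antisym; ≤-pred; ≰⇒>; <⇒≱; n≤1+n; 1+n≰n; n≮0)
open import Data.Fin using (Fin; zero; suc)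
open import Data.Fin.Properties using (any?)
open import Data.Fin.Subset using (Subset; ∣_∣; _∈_; _∉_; _⊆_; _∪_; _∩_; _-_; ⁅_⁆; ⊥; inside; outside)
open import Data.Fin.Subset.Properties
open import Data.Vec using (_∷_; []; here)
open import Data.Product using (Σ; ∃; _×_; _,_; proj₁; proj₂)
open import Data.Sum using (_⊎_; inj₁; inj₂)
open import Data.Bool using (T?)
open import Data.Empty using (⊥-elim)
open import Relation.Nullary using (¬_; Dec; yes; no; ¬?)
open import Relation.Nullary.Decidable using (_×-dec_; decidable-stable)
open import Relation.Binary.PropositionalEquality using (_≡_; _≢_; refl; sym; trans; cong; subst; subst₂)

private
  variable
    n : ℕ

p⊆q∧∣q∣≤∣p∣⇒p≡q : {p q : Subset n} → p ⊆ q → ∣ q ∣ ≤ ∣ p ∣ → p ≡ q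
p⊆q∧∣q∣≤∣p∣⇒p≡q {p = []} {[]} _ _ = refl
p⊆q∧∣q∣≤∣p∣⇒p≡q {p = outside ∷ p} {outside ∷ q} p⊆q ∣q∣≤∣p∣ = cong (outside ∷_) (p⊆q∧∣q∣≤∣p∣⇒p≡q (drop-∷-⊆ p⊆q) ∣q∣≤∣p∣)
p⊆q∧∣q∣≤∣p∣⇒p≡q {p = inside ∷ p} {inside ∷ q} p⊆q (s≤s ∣q∣≤∣p∣) = cong (inside ∷_) (p⊆q∧∣q∣≤∣p∣⇒p≡q (drop-∷-⊆ p⊆q) ∣q∣≤∣p∣)
p⊆q∧∣q∣≤∣p∣⇒p≡q {p = outside ∷ p} {inside ∷ q} p⊆q ∣q∣≤∣p∣ = ⊥-elim (1+n≰n (≤-trans ∣q∣≤∣p∣ (p⊆q⇒∣p∣≤∣q∣ (drop-∷-⊆ p⊆q))))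
p⊆q∧∣q∣≤∣p∣⇒p≡q {p = inside ∷ p} {outside ∷ q} p⊆q _ with p⊆q here
... | ()

p⊆q∧p≢q⇒∣p∣<∣q∣ : {p q : Subset n} → p ⊆ q → p ≢ q → ∣ p ∣ < ∣ q ∣
p⊆q∧p≢q⇒∣p∣<∣q∣ {p = p} {q} p⊆q p≢q with ∣ q ∣ ≤? ∣ p ∣
... | yes ∣q∣≤∣p∣ = ⊥-elim (p≢q (p⊆q∧∣q∣≤∣p∣⇒p≡q p⊆q ∣q∣≤∣p∣))
... | no ∣q∣≰∣p∣ = ≰⇒> ∣q∣≰∣p∣

∣p∣≤1+∣p-x∣ : (p : Subset n) (x : Fin n) → ∣ p ∣ ≤ suc ∣ p - x ∣
∣p∣≤1+∣p-x∣ (inside ∷ p) zero = s≤s (≤-reflexive (cong ∣_∣ (sym (p─⊥≡p p))))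
∣p∣≤1+∣p-x∣ (outside ∷ p) zero = ≤-trans (n≤1+n ∣ p ∣) (s≤s (≤-reflexive (cong ∣_∣ (sym (p─⊥≡p p)))))
∣p∣≤1+∣p-x∣ (inside ∷ p) (suc x) = s≤s (∣p∣≤1+∣p-x∣ p x)
∣p∣≤1+∣p-x∣ (outside ∷ p) (suc x) = ∣p∣≤1+∣p-x∣ p x

x∈p⇒∣p∣≡1+∣p-x∣ : {p : Subset n} {x : Fin n} → x ∈ p → ∣ p ∣ ≡ suc ∣ p - x ∣
x∈p⇒∣p∣≡1+∣p-x∣ {p = p} {x} x∈p = ≤-antisym (∣p∣≤1+∣p-x∣ p x) (x∈p⇒∣p-x∣<∣p∣ x∈p)

p⊆q∧x∉p⇒p⊆q-x : {p q : Subset n} {x : Fin n} → p ⊆ q → x ∉ p → p ⊆ q - x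
p⊆q∧x∉p⇒p⊆q-x p⊆q x∉p y∈p = x∈p∧x≢y⇒x∈p-y (p⊆q y∈p) λ { refl → x∉p y∈p }

p⊆q∧1+∣p∣≡∣q∣⇒p≡q-x : {p q : Subset n} → p ⊆ q → suc ∣ p ∣ ≡ ∣ q ∣ → ∃ λ x → x ∈ q × p ≡ q - x
p⊆q∧1+∣p∣≡∣q∣⇒p≡q-x {p = p} {q} p⊆q ∣q∣≡ with any? (λ x → x ∈? q ×-dec ¬? (x ∈? p))
... | yes (x , x∈q , x∉p) = x , x∈q , p⊆q∧∣q∣≤∣p∣⇒p≡q (p⊆q∧x∉p⇒p⊆q-x p⊆q x∉p) ∣q-x∣≤∣p∣
  where
  ∣q-x∣≤∣p∣ : ∣ q - x ∣ ≤ ∣ p ∣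
  ∣q-x∣≤∣p∣ = ≤-pred (≤-reflexive (trans (sym (x∈p⇒∣p∣≡1+∣p-x∣ x∈q)) (sym ∣q∣≡)))
... | no nothing-missing = ⊥-elim (<⇒≱ (≤-reflexive ∣q∣≡) (p⊆q⇒∣p∣≤∣q∣ q⊆p))
  where
  q⊆p : q ⊆ p
  q⊆p {x} x∈q = decidable-stable (x ∈? p) λ x∉p → nothing-missing (x , x∈q , x∉p)

∃-⊆-of-size : (k : ℕ) (p : Subset n) → k ≤ ∣ p ∣ → ∃ λ q → q ⊆ p × ∣ q ∣ ≡ k
∃-⊆-of-size {n} 0 p _ = ⊥ , ⊥⊆ , ∣⊥∣≡0 n
∃-⊆-of-size (suc k) (outside ∷ p) k<∣p∣ with ∃-⊆-of-size (suc k) p k<∣p∣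
... | q , q⊆p , ∣q∣≡ = outside ∷ q , s⊆s q⊆p , ∣q∣≡
∃-⊆-of-size (suc k) (inside ∷ p) (s≤s k≤∣p∣) with ∃-⊆-of-size k p k≤∣p∣
... | q , q⊆p , ∣q∣≡ = inside ∷ q , s⊆s q⊆p , cong suc ∣q∣≡

module _ {ℓ : ℕ} {𝒞 : Family n} (M : Matroid n) (generic : IsGeneric ℓ M)
         (circuits : CircuitsOfSize≡ ℓ M 𝒞) where

  generic-circuits-satisfy-Cond : Cond ℓ 𝒞
  generic-circuits-satisfy-Cond C₁ C₂ C₁∈𝒞 C₂∈𝒞 ∣V∣≡ X X⊆V ∣X∣≡
    with p⊆q∧1+∣p∣≡∣q∣⇒p≡q-x X⊆V (trans (cong suc ∣X∣≡) (sym ∣V∣≡))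
  ... | e , _ , refl = V-e∈𝒞 (e ∈? C₁) (e ∈? C₂)
    where
    V = C₁ ∪ C₂
    member-is-circuit : ∀ {C} → C ∈𝒞 𝒞 → IsCircuit M C
    member-is-circuit {C} C∈𝒞 = proj₁ (proj₂ (circuits C) C∈𝒞)
    ∣member∣≡ : ∀ C → C ∈𝒞 𝒞 → ∣ C ∣ ≡ suc ℓ
    ∣member∣≡ C C∈𝒞 = proj₂ (proj₂ (circuits C) C∈𝒞)
    fills-V-e : ∀ Y → Y ⊆ V - e → suc ℓ ≤ ∣ Y ∣ → Y ≡ V - e
    fills-V-e Y Y⊆V-e ℓ<∣Y∣ = p⊆q∧∣q∣≤∣p∣⇒p≡q Y⊆V-e (≤-trans (≤-reflexive ∣X∣≡) ℓ<∣Y∣)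
    via-member-avoiding-e : ∀ C → C ∈𝒞 𝒞 → C ⊆ V → e ∉ C → (V - e) ∈𝒞 𝒞
    via-member-avoiding-e C C∈𝒞 C⊆V e∉C =
      subst (_∈𝒞 𝒞) (fills-V-e C (p⊆q∧x∉p⇒p⊆q-x C⊆V e∉C) (≤-reflexive (sym (∣member∣≡ C C∈𝒞)))) C∈𝒞
    C₁≢C₂ : C₁ ≢ C₂
    C₁≢C₂ refl = 1+n≰n (≤-reflexive (trans (sym ∣V∣≡) (trans (cong ∣_∣ (∪-idem C₁)) (∣member∣≡ C₁ C₁∈𝒞))))
    via-elimination : e ∈ C₁ → e ∈ C₂ → (V - e) ∈𝒞 𝒞
    via-elimination e∈C₁ e∈C₂
      with elimination M C₁ C₂ e (member-is-circuit C₁∈𝒞) (member-is-circuit C₂∈𝒞) C₁≢C₂ (x∈p∩q⁺ (e∈C₁ , e∈C₂))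
    ... | C₃ , C₃-circuit , C₃⊆V-e =
      proj₁ (circuits (V - e)) (subst (IsCircuit M) (fills-V-e C₃ C₃⊆V-e (generic C₃ C₃-circuit)) C₃-circuit , ∣X∣≡)
    V-e∈𝒞 : Dec (e ∈ C₁) → Dec (e ∈ C₂) → (V - e) ∈𝒞 𝒞
    V-e∈𝒞 (no e∉C₁) _ = via-member-avoiding-e C₁ C₁∈𝒞 (p⊆p∪q C₂) e∉C₁
    V-e∈𝒞 (yes _) (no e∉C₂) = via-member-avoiding-e C₂ C₂∈𝒞 (q⊆p∪q C₁ C₂) e∉C₂
    V-e∈𝒞 (yes e∈C₁) (yes e∈C₂) = via-elimination e∈C₁ e∈C₂

module CircuitMatroid {ℓ : ℕ} (𝒞 : Family n) (∣𝒞∣≡ : ∀ X → X ∈𝒞 𝒞 → ∣ X ∣ ≡ suc ℓ) (cond : Cond ℓ 𝒞) where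

  𝒞-Free : Subset n → Set
  𝒞-Free X = ∀ Y → Y ⊆ X → ¬ Y ∈𝒞 𝒞

  Circuit : Subset n → Set
  Circuit X = X ∈𝒞 𝒞 ⊎ (∣ X ∣ ≡ suc (suc ℓ) × 𝒞-Free X)

  ∣circuit∣> : ∀ {X} → Circuit X → ℓ < ∣ X ∣
  ∣circuit∣> {X} (inj₁ X∈𝒞) = ≤-reflexive (sym (∣𝒞∣≡ X X∈𝒞))
  ∣circuit∣> (inj₂ (∣X∣≡ , _)) = ≤-trans (n≤1+n _) (≤-reflexive (sym ∣X∣≡))

  small-circuit∈𝒞 : ∀ {X} → Circuit X → ∣ X ∣ ≤ suc ℓ → X ∈𝒞 𝒞
  small-circuit∈𝒞 (inj₁ X∈𝒞) _ = X∈𝒞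
  small-circuit∈𝒞 (inj₂ (∣X∣≡ , _)) ∣X∣≤ = ⊥-elim (1+n≰n (subst (_≤ suc ℓ) ∣X∣≡ ∣X∣≤))

  ⊥-not-circuit : ¬ Circuit ⊥
  ⊥-not-circuit c = n≮0 (subst (ℓ <_) (∣⊥∣≡0 n) (∣circuit∣> c))

  circuit-⊆⇒∣∣≤ : ∀ {C₁ C₂} → Circuit C₁ → Circuit C₂ → C₁ ⊆ C₂ → ∣ C₂ ∣ ≤ ∣ C₁ ∣
  circuit-⊆⇒∣∣≤ {C₁} {C₂} (inj₁ C₁∈𝒞) (inj₁ C₂∈𝒞) _ = ≤-reflexive (trans (∣𝒞∣≡ C₂ C₂∈𝒞) (sym (∣𝒞∣≡ C₁ C₁∈𝒞)))
  circuit-⊆⇒∣∣≤ {C₁} (inj₁ C₁∈𝒞) (inj₂ (_ , C₂-free)) C₁⊆C₂ = ⊥-elim (C₂-free C₁ C₁⊆C₂ C₁∈𝒞)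
  circuit-⊆⇒∣∣≤ {C₂ = C₂} (inj₂ (∣C₁∣≡ , _)) (inj₁ C₂∈𝒞) C₁⊆C₂ =
    ⊥-elim (1+n≰n (subst₂ _≤_ ∣C₁∣≡ (∣𝒞∣≡ C₂ C₂∈𝒞) (p⊆q⇒∣p∣≤∣q∣ C₁⊆C₂)))
  circuit-⊆⇒∣∣≤ (inj₂ (∣C₁∣≡ , _)) (inj₂ (∣C₂∣≡ , _)) _ = ≤-reflexive (trans ∣C₂∣≡ (sym ∣C₁∣≡))

  circuit-incomparable : ∀ C₁ C₂ → Circuit C₁ → Circuit C₂ → C₁ ⊆ C₂ → C₁ ≡ C₂
  circuit-incomparable _ _ c₁ c₂ C₁⊆C₂ = p⊆q∧∣q∣≤∣p∣⇒p≡q C₁⊆C₂ (circuit-⊆⇒∣∣≤ c₁ c₂ C₁⊆C₂)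

  ∣circuit∣<∣∪∣ : ∀ {C D} → Circuit C → Circuit D → C ≢ D → ∣ C ∣ < ∣ C ∪ D ∣
  ∣circuit∣<∣∪∣ {C} {D} c d C≢D = p⊆q∧p≢q⇒∣p∣<∣q∣ (p⊆p∪q D) C≢C∪D
    where
    C≢C∪D : C ≢ C ∪ D
    C≢C∪D C≡C∪D = C≢D (sym (circuit-incomparable D C d c (subst (D ⊆_) (sym C≡C∪D) (q⊆p∪q C D))))

  circuit-within : ∀ U → suc (suc ℓ) ≤ ∣ U ∣ → ∃ λ C → Circuit C × C ⊆ U
  circuit-within U ℓ+1<∣U∣ with ∃-⊆-of-size (suc (suc ℓ)) U ℓ+1<∣U∣
  ... | W , W⊆U , ∣W∣≡ with anySubset? (λ Y → Y ⊆? W ×-dec T? (𝒞 Y))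
  ...   | yes (Y , Y⊆W , Y∈𝒞) = Y , inj₁ Y∈𝒞 , ⊆-trans Y⊆W W⊆U
  ...   | no no-member = W , inj₂ (∣W∣≡ , λ Y Y⊆W Y∈𝒞 → no-member (Y , Y⊆W , Y∈𝒞)) , W⊆U

  circuit-elimination : ∀ C₁ C₂ (e : Fin n) → Circuit C₁ → Circuit C₂ → C₁ ≢ C₂ → e ∈ C₁ ∩ C₂ →
                        ∃ λ C₃ → Circuit C₃ × C₃ ⊆ (C₁ ∪ C₂) - e
  circuit-elimination C₁ C₂ e c₁ c₂ C₁≢C₂ e∈C₁∩C₂ with suc (suc ℓ) ≤? ∣ (C₁ ∪ C₂) - e ∣
  ... | yes ℓ+1<∣V-e∣ = circuit-within _ ℓ+1<∣V-e∣
  ... | no ℓ+1≮∣V-e∣ = V - e , inj₁ V-e∈𝒞 , ⊆-refl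
    where
    V = C₁ ∪ C₂
    ∣V∣≡1+∣V-e∣ : ∣ V ∣ ≡ suc ∣ V - e ∣
    ∣V∣≡1+∣V-e∣ = x∈p⇒∣p∣≡1+∣p-x∣ (p⊆p∪q C₂ (proj₁ (x∈p∩q⁻ C₁ C₂ e∈C₁∩C₂)))
    ∣C₁∣<∣V∣ : ∣ C₁ ∣ < ∣ V ∣
    ∣C₁∣<∣V∣ = ∣circuit∣<∣∪∣ c₁ c₂ C₁≢C₂
    ∣C₂∣<∣V∣ : ∣ C₂ ∣ < ∣ V ∣
    ∣C₂∣<∣V∣ = subst (λ U → ∣ C₂ ∣ < ∣ U ∣) (∪-comm C₂ C₁) (∣circuit∣<∣∪∣ c₂ c₁ (λ C₂≡C₁ → C₁≢C₂ (sym C₂≡C₁)))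
    ∣V-e∣≡ : ∣ V - e ∣ ≡ suc ℓ
    ∣V-e∣≡ = ≤-antisym (≤-pred (≰⇒> ℓ+1≮∣V-e∣))
                       (≤-trans (∣circuit∣> c₁) (≤-pred (subst (∣ C₁ ∣ <_) ∣V∣≡1+∣V-e∣ ∣C₁∣<∣V∣)))
    ∣V∣≡ : ∣ V ∣ ≡ suc (suc ℓ)
    ∣V∣≡ = trans ∣V∣≡1+∣V-e∣ (cong suc ∣V-e∣≡)
    V-e∈𝒞 : (V - e) ∈𝒞 𝒞
    V-e∈𝒞 = cond C₁ C₂ (small-circuit∈𝒞 c₁ (≤-pred (subst (∣ C₁ ∣ <_) ∣V∣≡ ∣C₁∣<∣V∣)))
                       (small-circuit∈𝒞 c₂ (≤-pred (subst (∣ C₂ ∣ <_) ∣V∣≡ ∣C₂∣<∣V∣)))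
                       ∣V∣≡ (V - e) (p─q⊆p V ⁅ e ⁆) ∣V-e∣≡

  matroid : Matroid n
  matroid = record
    { IsCircuit = Circuit
    ; empty-not-circuit = ⊥-not-circuit
    ; incomparable = circuit-incomparable
    ; elimination = circuit-elimination
    }

  matroid-isGeneric : IsGeneric ℓ matroid
  matroid-isGeneric _ = ∣circuit∣>

  matroid-circuitsOfSize≡ : CircuitsOfSize≡ ℓ matroid 𝒞
  matroid-circuitsOfSize≡ X = (λ (c , ∣X∣≡) → small-circuit∈𝒞 c (≤-reflexive ∣X∣≡)) , λ X∈𝒞 → inj₁ X∈𝒞 , ∣𝒞∣≡ X X∈𝒞

lemma2p2 : (ℓ n : ℕ) → 1 ≤ ℓ → 1 ≤ n → (𝒞 : Family n) →
           (∀ (X : Subset n) → X ∈𝒞 𝒞 → ∣ X ∣ ≡ suc ℓ) →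
           (Cond ℓ 𝒞 → Σ (Matroid n) λ M → IsGeneric ℓ M × CircuitsOfSize≡ ℓ M 𝒞) ×
           (Σ (Matroid n) (λ M → IsGeneric ℓ M × CircuitsOfSize≡ ℓ M 𝒞) → Cond ℓ 𝒞)
lemma2p2 ℓ n _ _ 𝒞 ∣𝒞∣≡ = realise , λ (M , generic , circuits) → generic-circuits-satisfy-Cond M generic circuits
  where
  realise : Cond ℓ 𝒞 → Σ (Matroid n) λ M → IsGeneric ℓ M × CircuitsOfSize≡ ℓ M 𝒞
  realise cond = matroid , matroid-isGeneric , matroid-circuitsOfSize≡
    where open CircuitMatroid 𝒞 ∣𝒞∣≡ cond
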